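{- The Hopf algebra $\mathit{LR}$ is the free associative algebra generated by $\{M^*_t\mid t\text{ progressive}\}$, and for all planar binary trees $s,t$, $$M^*_s\cdot M^*_t=M^*_{s\backslash t}.$$
   Context: $\mathcal{Y}_n$: rooted planar binary trees with $n$ internal nodes, $\mathcal{Y}_0=\{|\}$, each $t$ ($n\ge1$) uniquely $t_l\vee t_r$; Tamari order generated by replacing a subtree $(A\vee B)\vee C$ by $A\vee(B\vee C)$. $|\backslash t=t$, $s\backslash t=s_l\vee(s_r\backslash t)$. A tree $t\ne|$ is progressive if $t_r=|$. $\mathcal{Y}Sym$: the graded Hopf algebra over $\mathbb{Q}$ with basis $F_t$ and coproduct $\Delta(F_t)=\sum_{i=0}^nF_{\lambda(\mathrm{st}(\gamma(t)(1..i)))}\otimes F_{\lambda(\mathrm{st}(\gamma(t)(i+1..n)))}$, where $\lambda(\mathrm{id}_0)=|$, $\lambda(\sigma)=\lambda(\mathrm{st}(\sigma(1..j-1)))\vee\lambda(\mathrm{st}(\sigma(j+1..n)))$ with $j=\sigma^{ -1}(n)$, $\gamma(|)=\mathrm{id}_0$, $\gamma(t)=\gamma(t_l)\vee\gamma(t_r)$, the permutation $\sigma\vee\tau$ ($\sigma\in\mathfrak{S}_p,\tau\in\mathfrak{S}_q$) has values $\sigma(1)+q,\dots,\sigma(p)+q,p+q+1,\tau(1),\dots,\tau(q)$, and st is standardization. Monomial basis $M_t=\sum_{s\ge t}\mu_{\mathcal{Y}_n}(t,s)F_s$ (Tamari Möbius function). $\mathit{LR}$ (the Loday–Ronco Hopf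 algebra) is the graded dual Hopf algebra of $\mathcal{Y}Sym$, and $\{M^*_t\}$ is the basis dual to $\{M_t\}$. -}

module Defs where

open import Data.Nat using (ℕ; zero; suc; _+_; _<_; _<?_; _≡ᵇ_)
open import Data.Bool using (Bool; true; false; if_then_else_; _∧_)
open import Data.List using (List; []; _∷_; _++_; map; filter; length; take; drop; upTo; concatMap; zipWith; reverse; foldr)
open import Data.List.Relation.Unary.All using (All)
open import Data.List.Relation.Unary.Unique.Propositional using (Unique)
open import Data.Product using (Σ; _×_; _,_; proj₁; proj₂; ∃)
open import Data.Rational using (ℚ; 0ℚ; 1ℚ; _*_) renaming (_+_ to _+ℚ_)
open import Relation.Nullary using (Dec; yes; no; ¬_)
open import Relation.Nullary.Decidable using (⌊_⌋)
open import Relation.Binary.PropositionalEquality using (_≡_; refl; cong₂)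
open import Relation.Binary.Construct.Closure.ReflexiveTransitive using (Star)

data Tree : Set where
  leaf : Tree                  -- the tree |
  node : Tree → Tree → Tree    -- node l r = l ∨ r

size : Tree → ℕ
size leaf = 0
size (node l r) = suc (size l + size r)

_≟T_ : (s t : Tree) → Dec (s ≡ t)
leaf ≟T leaf = yes refl
leaf ≟T node _ _ = no (λ ())
node _ _ ≟T leaf = no (λ ())
node a b ≟T node c d with a ≟T c | b ≟T d
... | yes refl | yes refl = yes refl
... | no p | _ = no (λ { refl → p refl })
... | yes _ | no q = no (λ { refl → q refl })

-- Enumeration of 𝒴_n: levels n = [𝒴_n , 𝒴_{n-1} , … , 𝒴_0]
combine : List Tree → List Tree → List Tree
combine A B = concatMap (λ a → map (node a) B) A

levels : ℕ → List (List Tree)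
levels zero = (leaf ∷ []) ∷ []
levels (suc n) = foldr _++_ [] (zipWith combine (reverse L) L) ∷ L
  where L = levels n

trees : ℕ → List Tree
trees n with levels n
... | x ∷ _ = x
... | [] = []

data _⋖_ : Tree → Tree → Set where
  rot   : ∀ A B C → node (node A B) C ⋖ node A (node B C)
  left  : ∀ {t t'} r → t ⋖ t' → node t r ⋖ node t' r
  right : ∀ {t t'} l → t ⋖ t' → node l t ⋖ node l t'

_≤T_ : Tree → Tree → Set
_≤T_ = Star _⋖_

_⧵_ : Tree → Tree → Tree
leaf ⧵ t = t
node l r ⧵ t = node l (r ⧵ t)

data Progressive : Tree → Set where
  prog : ∀ l → Progressive (node l leaf)

-- Permutations (as lists of values σ(1),…,σ(n)), γ, st, λ

γ : Tree → List ℕ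
γ leaf = []
γ (node l r) = map (λ x → x + size r) (γ l) ++ (size l + size r + 1) ∷ γ r

st : List ℕ → List ℕ
st xs = map (λ x → suc (length (filter (λ y → y <? x) xs))) xs

-- 0-based position of the first occurrence of v
indexOf : ℕ → List ℕ → ℕ
indexOf v [] = 0
indexOf v (x ∷ xs) = if x ≡ᵇ v then 0 else suc (indexOf v xs)

-- λ with fuel (fuel = length suffices)
lam : ℕ → List ℕ → Tree
lam zero _ = leaf
lam (suc k) [] = leaf
lam (suc k) (x ∷ xs) =
  node (lam k (st (take j σ))) (lam k (st (drop (suc j) σ)))
  where
    σ = x ∷ xs
    j = indexOf (length σ) σ      -- j - 1 where j = σ⁻¹(n)

Λ : List ℕ → Tree
Λ σ = lam (length σ) σ

sumℚ : List ℚ → ℚ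
sumℚ = foldr _+ℚ_ 0ℚ

δ : Tree → Tree → ℚ
δ t s = if ⌊ t ≟T s ⌋ then 1ℚ else 0ℚ

-- a linear functional on 𝒴Sym, given by its values on the basis F_s
Fun : Set
Fun = Tree → ℚ

-- product of LR = transpose of the coproduct Δ of 𝒴Sym:
-- (f · g)(F_u) = (f ⊗ g)(Δ F_u)
_⊙_ : Fun → Fun → Fun
(f ⊙ g) u = sumℚ (map (λ i → f (Λ (st (take i (γ u)))) * g (Λ (st (drop i (γ u)))))
                      (upTo (suc (size u))))

-- unit of LR (dual to the counit): F_| ↦ 1, other F_s ↦ 0
unitLR : Fun
unitLR = δ leaf

-- finitely many nonzero degrees (elements of the graded dual)
FinDeg : Fun → Set
FinDeg f = ∃ λ N → ∀ u → N < size u → f u ≡ 0ℚ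

module _ (dec : ∀ s t → Dec (s ≤T t)) (μ : Tree → Tree → ℚ) where

  IsMobius : Set
  IsMobius = ∀ t s → t ≤T s →
    sumℚ (map (λ u → if ⌊ dec t u ⌋ ∧ ⌊ dec u s ⌋ then μ t u else 0ℚ) (trees (size t)))
      ≡ δ t s

  -- ⟨ φ , M_s ⟩ where M_s = Σ_{v ≥ s} μ(s,v) F_v
  pairM : Fun → Tree → ℚ
  pairM φ s = sumℚ (map (λ v → if ⌊ dec s v ⌋ then μ s v * φ v else 0ℚ) (trees (size s)))

  IsDualBasis : (Tree → Fun) → Set
  IsDualBasis Mst =
    (∀ t s → ¬ (size s ≡ size t) → Mst t s ≡ 0ℚ) ×
    (∀ t s → size s ≡ size t → pairM (Mst t) s ≡ δ t s)

wordProd : (Tree → Fun) → List Tree → Fun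
wordProd Mst [] = unitLR
wordProd Mst (p ∷ w) = Mst p ⊙ wordProd Mst w

lincomb : (Tree → Fun) → List (ℚ × List Tree) → Fun
lincomb Mst cw u = sumℚ (map (λ cw₁ → proj₁ cw₁ * wordProd Mst (proj₂ cw₁) u) cw)

-- LR is the free associative algebra on {M*_t | t progressive}:
-- the words (monomials) in these generators form a ℚ-basis of LR.
IsFreeOnProgressive : (Tree → Fun) → Set
IsFreeOnProgressive Mst =
  (∀ (cw : List (ℚ × List Tree)) →
     All (λ x → All Progressive (proj₂ x)) cw →
     Unique (map proj₂ cw) →
     (∀ u → lincomb Mst cw u ≡ 0ℚ) →
     All (λ x → proj₁ x ≡ 0ℚ) cw) ×
  (∀ (f : Fun) → FinDeg f →
     ∃ λ (cw : List (ℚ × List Tree)) →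
       All (λ x → All Progressive (proj₂ x)) cw × (∀ u → f u ≡ lincomb Mst cw u))

{-# OPTIONS --safe #-}

-- M*_t is the indicator χ t of the lower Tamari interval below t, i.e. the functional
-- F_v ↦ [v ≤ t]: pairing χ t with M_s = Σ_{v ≥ s} μ(s,v) F_v gives δ by the Möbius
-- identity, and a functional is determined by these pairings because they are
-- unitriangular for the Tamari order. The i-th term of Δ F_u is F_{u'} ⊗ F_{u''} where
-- u' and u'' are the prefix and suffix of u at i, and u ≤ s \ t iff u' ≤ s and u'' ≤ t
-- for i = |s|; hence χ s · χ t = χ (s \ t). Every tree is uniquely p₁ \ (p₂ \ ⋯ \ |)
-- with all p_k progressive, so the monomials in progressive trees are exactly the
-- χ t, which form a basis of the graded dual, again by unitriangularity.

module Submission where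

open import Defs
open import Data.Nat using (ℕ; zero; suc; _+_; _∸_; _≤_; _<_; _≡ᵇ_; z≤n; s≤s; s≤s⁻¹; z<s)
open import Data.Nat.Properties
open import Data.Nat.Induction using (<-wellFounded)
open import Data.Nat.Solver using (module +-*-Solver)
open import Data.Rational.Solver renaming (module +-*-Solver to +-*-Solverℚ)
open import Data.Bool using (T; true; false; if_then_else_; _∧_)
open import Data.List using (List; []; _∷_; _++_; map; filter; length; take; drop; upTo; concatMap; deduplicate; foldr)
open import Data.Nat.ListAction using (sum)
open import Data.List.Properties
  using (map-++; map-∘; map-cong; map-cong-local; map-id-local; length-map; length-++; take-map; drop-map; take-[]; drop-[]; take-all;
         filter-accept; filter-reject; filter-all; filter-none; filter-++)
open import Data.List.Relation.Unary.All as All using (All; []; _∷_)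
open import Data.List.Relation.Unary.All.Properties using (map⁺; map⁻; ++⁺; take⁺; drop⁺)
open import Data.List.Membership.Propositional using (_∈_)
open import Data.List.Membership.Propositional.Properties
  using (∈-upTo⁺; ∈-upTo⁻; ∈-map⁺; ∈-concatMap⁺; ∈-filter⁺; ∈-filter⁻; ∈-deduplicate⁺)
import Data.List.Relation.Unary.Unique.DecPropositional.Properties as DecUnique
open import Data.List.Relation.Unary.Any as Any using (here; there)
open import Data.List.Relation.Unary.Unique.Propositional using (Unique)
open import Data.List.Relation.Unary.Unique.Propositional.Properties as Unique using (upTo⁺)
open import Data.List.Relation.Unary.AllPairs using ([]; _∷_)
open import Data.Product using (_×_; _,_; proj₁; proj₂; ∃; map₂)
open import Data.Empty using (⊥-elim)
open import Data.Sum using (inj₁; inj₂)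
open import Function using (flip; _∘_; id)
open import Induction.WellFounded using (WellFounded; module Subrelation) renaming (module All to WfAll)
import Relation.Binary.Construct.On as On
open import Data.Rational using (ℚ; 0ℚ; 1ℚ; _*_; _-_) renaming (_+_ to _+ℚ_)
import Data.Rational.Properties as ℚ
open import Algebra.Properties.Group ℚ.+-0-group using (x∙y⁻¹≈ε⇒x≈y; //-rightDividesˡ)
open import Relation.Nullary using (Dec; yes; no; ¬_)
open import Relation.Nullary.Decidable using (⌊_⌋)
open import Relation.Binary.PropositionalEquality
open import Relation.Binary.Construct.Closure.ReflexiveTransitive using (ε; _◅_; _◅◅_; gmap)

open ≡-Reasoning

-- The Tamari order and s ⧵ t

⋖-size : ∀ {t t'} → t ⋖ t' → size t ≡ size t'
⋖-size (rot A B C) = cong suc (trans (cong suc (+-assoc (size A) (size B) (size C))) (sym (+-suc (size A) _)))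
⋖-size (left r p) = cong (λ x → suc (x + size r)) (⋖-size p)
⋖-size (right l p) = cong (λ x → suc (size l + x)) (⋖-size p)

≤T-size : ∀ {t t'} → t ≤T t' → size t ≡ size t'
≤T-size ε = refl
≤T-size (x ◅ p) = trans (⋖-size x) (≤T-size p)

leftWeight : Tree → ℕ
leftWeight leaf = 0
leftWeight (node l r) = leftWeight l + leftWeight r + size l

⋖-leftWeight : ∀ {t t'} → t ⋖ t' → leftWeight t' < leftWeight t
⋖-leftWeight (rot A B C) =
  subst (leftWeight (node A (node B C)) <_) (weight-drop (leftWeight A) (leftWeight B) (leftWeight C) (size A) (size B)) (m<m+n _ z<s)
  where
  open +-*-Solver
  -- the rotation lowers leftWeight by exactly 1 + size A
  weight-drop : ∀ a b c x y → a + (b + c + y) + x + suc x ≡ a + b + x + c + suc (x + y)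
  weight-drop = solve 5 (λ a b c x y → a :+ (b :+ c :+ y) :+ x :+ (con 1 :+ x) := a :+ b :+ x :+ c :+ (con 1 :+ (x :+ y))) refl
⋖-leftWeight (left {t} {t'} r p) rewrite ⋖-size p = +-monoˡ-< (size t') (+-monoˡ-< (leftWeight r) (⋖-leftWeight p))
⋖-leftWeight (right l p) = +-monoˡ-< (size l) (+-monoʳ-< (leftWeight l) (⋖-leftWeight p))

≤T-leftWeight : ∀ {t t'} → t ≤T t' → leftWeight t' ≤ leftWeight t
≤T-leftWeight ε = ≤-refl
≤T-leftWeight (x ◅ p) = ≤-trans (≤T-leftWeight p) (<⇒≤ (⋖-leftWeight x))

_<T_ : Tree → Tree → Set
s <T t = s ≤T t × ¬ s ≡ t

<T-leftWeight : ∀ {s t} → s <T t → leftWeight t < leftWeight s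
<T-leftWeight (ε , s≢t) = ⊥-elim (s≢t refl)
<T-leftWeight (x ◅ p , _) = ≤-<-trans (≤T-leftWeight p) (⋖-leftWeight x)

≤T-antisym : ∀ {s t} → s ≤T t → t ≤T s → s ≡ t
≤T-antisym ε _ = refl
≤T-antisym (x ◅ p) q = ⊥-elim (<⇒≱ (≤-<-trans (≤T-leftWeight p) (⋖-leftWeight x)) (≤T-leftWeight q))

>T-wellFounded : WellFounded (flip _<T_)
>T-wellFounded = Subrelation.wellFounded <T-leftWeight (On.wellFounded leftWeight <-wellFounded)

>T-rec : (P : Tree → Set) → (∀ s → (∀ {t} → s <T t → P t) → P s) → ∀ s → P s
>T-rec = WfAll.wfRec >T-wellFounded _

size-⧵ : ∀ s t → size (s ⧵ t) ≡ size s + size t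
size-⧵ leaf t = refl
size-⧵ (node l r) t = cong suc (trans (cong (size l +_) (size-⧵ r t)) (sym (+-assoc (size l) (size r) (size t))))

⧵-⋖ʳ : ∀ s {t t'} → t ⋖ t' → (s ⧵ t) ⋖ (s ⧵ t')
⧵-⋖ʳ leaf p = p
⧵-⋖ʳ (node l r) p = right l (⧵-⋖ʳ r p)

⧵-⋖ˡ : ∀ {s s'} t → s ⋖ s' → (s ⧵ t) ⋖ (s' ⧵ t)
⧵-⋖ˡ t (rot A B C) = rot A B (C ⧵ t)
⧵-⋖ˡ t (left r p) = left (r ⧵ t) p
⧵-⋖ˡ t (right l p) = right l (⧵-⋖ˡ t p)

⧵-mono-≤T : ∀ {s s' t t'} → s ≤T s' → t ≤T t' → (s ⧵ t) ≤T (s' ⧵ t')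
⧵-mono-≤T {s' = s'} {t = t} p q = gmap (_⧵ t) (⧵-⋖ˡ t) p ◅◅ gmap (s' ⧵_) (⧵-⋖ʳ s') q

node-monoˡ-≤T : ∀ r {t t'} → t ≤T t' → node t r ≤T node t' r
node-monoˡ-≤T r = gmap (λ x → node x r) (left r)

node-monoʳ-≤T : ∀ l {t t'} → t ≤T t' → node l t ≤T node l t'
node-monoʳ-≤T l = gmap (node l) (right l)

node-⧵-≤T : ∀ s t r → node (s ⧵ t) r ≤T (s ⧵ node t r)
node-⧵-≤T leaf t r = ε
node-⧵-≤T (node a b) t r = rot a (b ⧵ t) r ◅ node-monoʳ-≤T a (node-⧵-≤T b t r)

-- Prefix and suffix of a tree

prefix : Tree → ℕ → Tree
prefix leaf i = leaf
prefix (node l r) i with i ≤? size l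
... | yes _ = prefix l i
... | no _ = node l (prefix r (i ∸ suc (size l)))

suffix : Tree → ℕ → Tree
suffix leaf i = leaf
suffix (node l r) i with i ≤? size l
... | yes _ = node (suffix l i) r
... | no _ = suffix r (i ∸ suc (size l))

module _ {l r : Tree} {i : ℕ} where

  prefix-node-≤ : i ≤ size l → prefix (node l r) i ≡ prefix l i
  prefix-node-≤ h with i ≤? size l
  ... | yes _ = refl
  ... | no h' = ⊥-elim (h' h)

  prefix-node-≰ : ¬ i ≤ size l → prefix (node l r) i ≡ node l (prefix r (i ∸ suc (size l)))
  prefix-node-≰ h with i ≤? size l
  ... | yes h' = ⊥-elim (h h')
  ... | no _ = refl

  suffix-node-≤ : i ≤ size l → suffix (node l r) i ≡ node (suffix l i) r
  suffix-node-≤ h with i ≤? size l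
  ... | yes _ = refl
  ... | no h' = ⊥-elim (h' h)

  suffix-node-≰ : ¬ i ≤ size l → suffix (node l r) i ≡ suffix r (i ∸ suc (size l))
  suffix-node-≰ h with i ≤? size l
  ... | yes h' = ⊥-elim (h h')
  ... | no _ = refl

prefix-zero : ∀ u → prefix u 0 ≡ leaf
prefix-zero leaf = refl
prefix-zero (node l r) = trans (prefix-node-≤ {l} {r} z≤n) (prefix-zero l)

suffix-zero : ∀ u → suffix u 0 ≡ u
suffix-zero leaf = refl
suffix-zero (node l r) = trans (suffix-node-≤ {l} {r} z≤n) (cong (λ x → node x r) (suffix-zero l))

prefix-⧵ : ∀ s t → prefix (s ⧵ t) (size s) ≡ s
prefix-⧵ leaf t = prefix-zero t
prefix-⧵ (node l r) t = trans (prefix-node-≰ (m+n≮m (size l) (size r)))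
  (cong (node l) (trans (cong (prefix (r ⧵ t)) (m+n∸m≡n (size l) (size r))) (prefix-⧵ r t)))

suffix-⧵ : ∀ s t → suffix (s ⧵ t) (size s) ≡ t
suffix-⧵ leaf t = suffix-zero t
suffix-⧵ (node l r) t = trans (suffix-node-≰ (m+n≮m (size l) (size r)))
  (trans (cong (suffix (r ⧵ t)) (m+n∸m≡n (size l) (size r))) (suffix-⧵ r t))

≤T-prefix⧵suffix : ∀ u i → u ≤T (prefix u i ⧵ suffix u i)
≤T-prefix⧵suffix leaf i = ε
≤T-prefix⧵suffix (node l r) i with i ≤? size l
... | yes _ = node-monoˡ-≤T r (≤T-prefix⧵suffix l i) ◅◅ node-⧵-≤T (prefix l i) (suffix l i) r
... | no _ = node-monoʳ-≤T l (≤T-prefix⧵suffix r _)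

m≤1+n+o⇒m∸1+n≤o : ∀ {m} n o → m ≤ suc (n + o) → m ∸ suc n ≤ o
m≤1+n+o⇒m∸1+n≤o n o h = ≤-trans (∸-monoˡ-≤ (suc n) h) (≤-reflexive (m+n∸m≡n n o))

m≰1+n+o⇒m∸1+n≰o : ∀ {m} n o → ¬ m ≤ suc (n + o) → ¬ m ∸ suc n ≤ o
m≰1+n+o⇒m∸1+n≰o {m} n o h h' = h (≤-trans (m≤n+m∸n m (suc n)) (s≤s (+-monoʳ-≤ n h')))

m≰1+n+o⇒m≰n : ∀ {m} n o → ¬ m ≤ suc (n + o) → ¬ m ≤ n
m≰1+n+o⇒m≰n n o h h' = h (≤-trans h' (≤-trans (m≤m+n n o) (n≤1+n _)))

m≰n⇒m≡n+[1+m∸1+n] : ∀ {m n} → ¬ m ≤ n → m ≡ n + suc (m ∸ suc n)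
m≰n⇒m≡n+[1+m∸1+n] {m} {n} m≰n = trans (sym (m+[n∸m]≡n (≰⇒> m≰n))) (sym (+-suc n (m ∸ suc n)))

size-prefix : ∀ u {i} → i ≤ size u → size (prefix u i) ≡ i
size-prefix leaf z≤n = refl
size-prefix (node l r) {i} h with i ≤? size l
... | yes h' = size-prefix l h'
... | no h' = trans (cong (λ x → suc (size l + x)) (size-prefix r (m≤1+n+o⇒m∸1+n≤o (size l) (size r) h)))
                    (m+[n∸m]≡n (≰⇒> h'))

prefix-⋖ : ∀ {u u'} → u ⋖ u' → ∀ i → prefix u i ≤T prefix u' i
prefix-⋖ (rot A B C) i with i ≤? suc (size A + size B)
... | yes i≤AB with i ≤? size A
...   | yes _ = ε
...   | no _ rewrite prefix-node-≤ {r = C} (m≤1+n+o⇒m∸1+n≤o (size A) (size B) i≤AB) = ε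
prefix-⋖ (rot A B C) i | no i≰AB
  rewrite prefix-node-≰ {r = node B C} (m≰1+n+o⇒m≰n (size A) (size B) i≰AB)
        | prefix-node-≰ {r = C} (m≰1+n+o⇒m∸1+n≰o (size A) (size B) i≰AB)
        | ∸-+-assoc i (suc (size A)) (suc (size B))
        | +-suc (size A) (size B) = rot A B _ ◅ ε
prefix-⋖ (left {t} {t'} r p) i with i ≤? size t
... | yes h rewrite prefix-node-≤ {r = r} (subst (i ≤_) (⋖-size p) h) = prefix-⋖ p i
... | no h rewrite prefix-node-≰ {r = r} (subst (λ n → ¬ i ≤ n) (⋖-size p) h) | ⋖-size p = left _ p ◅ ε
prefix-⋖ (right l p) i with i ≤? size l
... | yes _ = ε
... | no _ = node-monoʳ-≤T l (prefix-⋖ p _)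

suffix-⋖ : ∀ {u u'} → u ⋖ u' → ∀ i → suffix u i ≤T suffix u' i
suffix-⋖ (rot A B C) i with i ≤? suc (size A + size B)
... | yes i≤AB with i ≤? size A
...   | yes _ = rot _ B C ◅ ε
...   | no _ rewrite suffix-node-≤ {r = C} (m≤1+n+o⇒m∸1+n≤o (size A) (size B) i≤AB) = ε
suffix-⋖ (rot A B C) i | no i≰AB
  rewrite suffix-node-≰ {r = node B C} (m≰1+n+o⇒m≰n (size A) (size B) i≰AB)
        | suffix-node-≰ {r = C} (m≰1+n+o⇒m∸1+n≰o (size A) (size B) i≰AB)
        | ∸-+-assoc i (suc (size A)) (suc (size B))
        | +-suc (size A) (size B) = ε
suffix-⋖ (left {t} {t'} r p) i with i ≤? size t
... | yes h rewrite suffix-node-≤ {r = r} (subst (i ≤_) (⋖-size p) h) = node-monoˡ-≤T r (suffix-⋖ p i)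
... | no h rewrite suffix-node-≰ {r = r} (subst (λ n → ¬ i ≤ n) (⋖-size p) h) | ⋖-size p = ε
suffix-⋖ (right l p) i with i ≤? size l
... | yes _ = right _ p ◅ ε
... | no _ = suffix-⋖ p _

prefix-mono-≤T : ∀ {u u'} → u ≤T u' → ∀ i → prefix u i ≤T prefix u' i
prefix-mono-≤T ε i = ε
prefix-mono-≤T (x ◅ p) i = prefix-⋖ x i ◅◅ prefix-mono-≤T p i

suffix-mono-≤T : ∀ {u u'} → u ≤T u' → ∀ i → suffix u i ≤T suffix u' i
suffix-mono-≤T ε i = ε
suffix-mono-≤T (x ◅ p) i = suffix-⋖ x i ◅◅ suffix-mono-≤T p i

≤T-⧵⁺ : ∀ {s t u} → prefix u (size s) ≤T s → suffix u (size s) ≤T t → u ≤T (s ⧵ t)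
≤T-⧵⁺ {s} {u = u} p q = ≤T-prefix⧵suffix u (size s) ◅◅ ⧵-mono-≤T p q

≤T-⧵⁻ : ∀ {s t u} → u ≤T (s ⧵ t) → prefix u (size s) ≤T s × suffix u (size s) ≤T t
≤T-⧵⁻ {s} {t} {u} p =
  subst (prefix u (size s) ≤T_) (prefix-⧵ s t) (prefix-mono-≤T p (size s)) ,
  subst (suffix u (size s) ≤T_) (suffix-⧵ s t) (suffix-mono-≤T p (size s))

-- Standardization and the permutations γ t

take-++ˡ : ∀ {A : Set} {i} (α ys : List A) → i ≤ length α → take i (α ++ ys) ≡ take i α
take-++ˡ {i = zero} α ys _ = refl
take-++ˡ {i = suc i} (x ∷ α) ys (s≤s h) = cong (x ∷_) (take-++ˡ α ys h)

take-++ʳ : ∀ {A : Set} (α : List A) j ys → take (length α + j) (α ++ ys) ≡ α ++ take j ys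
take-++ʳ [] j ys = refl
take-++ʳ (x ∷ α) j ys = cong (x ∷_) (take-++ʳ α j ys)

drop-++ˡ : ∀ {A : Set} {i} (α ys : List A) → i ≤ length α → drop i (α ++ ys) ≡ drop i α ++ ys
drop-++ˡ {i = zero} α ys _ = refl
drop-++ˡ {i = suc i} (x ∷ α) ys (s≤s h) = drop-++ˡ α ys h

drop-++ʳ : ∀ {A : Set} (α : List A) j ys → drop (length α + j) (α ++ ys) ≡ drop j ys
drop-++ʳ [] j ys = refl
drop-++ʳ (x ∷ α) j ys = drop-++ʳ α j ys

infix 6 _∨ₚ_

_∨ₚ_ : List ℕ → List ℕ → List ℕ
σ ∨ₚ τ = map (_+ length τ) σ ++ (length σ + length τ + 1) ∷ τ

countBelow : ℕ → List ℕ → ℕ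
countBelow x xs = length (filter (_<? x) xs)

countBelow-map-+ : ∀ c x σ → countBelow (x + c) (map (_+ c) σ) ≡ countBelow x σ
countBelow-map-+ c x [] = refl
countBelow-map-+ c x (y ∷ σ) with y <? x
... | yes y<x = begin
  length (filter (_<? x + c) (y + c ∷ map (_+ c) σ)) ≡⟨ cong length (filter-accept (_<? x + c) (+-monoˡ-< c y<x)) ⟩
  suc (countBelow (x + c) (map (_+ c) σ))           ≡⟨ cong suc (countBelow-map-+ c x σ) ⟩
  suc (countBelow x σ)                               ≡⟨ cong length (filter-accept (_<? x) y<x) ⟨
  countBelow x (y ∷ σ)                               ∎
... | no y≮x = begin
  length (filter (_<? x + c) (y + c ∷ map (_+ c) σ)) ≡⟨ cong length (filter-reject (_<? x + c) (y≮x ∘ +-cancelʳ-< c y x)) ⟩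
  countBelow (x + c) (map (_+ c) σ)                 ≡⟨ countBelow-map-+ c x σ ⟩
  countBelow x σ                                     ≡⟨ cong length (filter-reject (_<? x) y≮x) ⟨
  countBelow x (y ∷ σ)                               ∎

countBelow-++ : ∀ x α β → countBelow x (α ++ β) ≡ countBelow x α + countBelow x β
countBelow-++ x α β = trans (cong length (filter-++ (_<? x) α β)) (length-++ (filter (_<? x) α))

countBelow-all : ∀ {x β} → All (_< x) β → countBelow x β ≡ length β
countBelow-all {x} h = cong length (filter-all (_<? x) h)

countBelow-none : ∀ {x α} → All (λ y → ¬ y < x) α → countBelow x α ≡ 0
countBelow-none {x} h = cong length (filter-none (_<? x) h)

length-st : ∀ σ → length (st σ) ≡ length σ
length-st σ = length-map _ σ

st-map-+ : ∀ c σ → st (map (_+ c) σ) ≡ st σ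
st-map-+ c σ = trans (sym (map-∘ σ)) (map-cong-local (All.tabulate (λ {x} _ → cong suc (countBelow-map-+ c x σ))))

st-++-∷ : ∀ α m β → All (_< m) α → All (_< m) β → All (λ x → All (_< x) β) α → st (α ++ m ∷ β) ≡ st α ∨ₚ st β
st-++-∷ α m β α<m β<m β<α rewrite length-st α | length-st β = trans (map-++ rank α (m ∷ β)) (cong₂ _++_ on-α (cong₂ _∷_ on-m on-β))
  where
  rank : ℕ → ℕ
  rank x = suc (countBelow x (α ++ m ∷ β))
  reject : ∀ {x} y → ¬ y < x → countBelow x (y ∷ β) ≡ countBelow x β
  reject {x} y y≮x = cong length (filter-reject (_<? x) y≮x)
  on-α : map rank α ≡ map (_+ length β) (st α)
  on-α = trans (map-cong-local (All.zipWith (λ (x<m , β<x) → rank-α x<m β<x) (α<m , β<α))) (map-∘ α)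
    where
    rank-α : ∀ {x} → x < m → All (_< x) β → rank x ≡ suc (countBelow x α) + length β
    rank-α {x} x<m β<x = cong suc (trans (countBelow-++ x α (m ∷ β))
      (cong (countBelow x α +_) (trans (reject m (<-asym x<m)) (countBelow-all β<x))))
  on-m : rank m ≡ length α + length β + 1
  on-m = trans (cong suc (trans (countBelow-++ m α (m ∷ β))
      (cong₂ _+_ (countBelow-all α<m) (trans (reject m (<-irrefl refl)) (countBelow-all β<m))))) (+-comm 1 _)
  on-β : map rank β ≡ st β
  on-β = map-cong-local (All.tabulate rank-β)
    where
    rank-β : ∀ {x} → x ∈ β → rank x ≡ suc (countBelow x β)
    rank-β x∈β = cong suc (trans (countBelow-++ _ α (_ ∷ β))
      (cong₂ _+_ (countBelow-none (All.map (λ β<y y<x → <-asym y<x (All.lookup β<y x∈β)) β<α))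
                 (reject m (<-asym (All.lookup β<m x∈β)))))

map-+-bounded : ∀ {a} b {α} → All (_≤ a) α → All (_< a + b + 1) (map (_+ b) α)
map-+-bounded {a} b α≤a = map⁺ (All.map (λ x≤a → ≤-<-trans (+-monoˡ-≤ b x≤a) (m<m+n (a + b) z<s)) α≤a)

st-shifted-∨ : ∀ {a b α β} → All (0 <_) α → All (_≤ a) α → All (_≤ b) β →
  st (map (_+ b) α ++ (a + b + 1) ∷ β) ≡ st α ∨ₚ st β
st-shifted-∨ {a} {b} {α} {β} α>0 α≤a β≤b =
  trans (st-++-∷ (map (_+ b) α) (a + b + 1) β (map-+-bounded b α≤a) β<m β<shifted-α)
        (cong (_∨ₚ st β) (st-map-+ b α))
  where
  β<m : All (_< a + b + 1) β
  β<m = All.map (λ y≤b → ≤-<-trans (≤-trans y≤b (m≤n+m b a)) (m<m+n (a + b) z<s)) β≤b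
  β<shifted-α : All (λ x → All (_< x) β) (map (_+ b) α)
  β<shifted-α = map⁺ (All.map (λ x>0 → All.map (λ y≤b → ≤-<-trans y≤b (m<n+m b x>0)) β≤b) α>0)

length-γ : ∀ t → length (γ t) ≡ size t
length-γ leaf = refl
length-γ (node l r) = begin
  length (map (_+ size r) (γ l) ++ (size l + size r + 1) ∷ γ r) ≡⟨ length-++ (map (_+ size r) (γ l)) ⟩
  length (map (_+ size r) (γ l)) + suc (length (γ r))            ≡⟨ cong₂ (λ a b → a + suc b) (trans (length-map _ (γ l)) (length-γ l)) (length-γ r) ⟩
  size l + suc (size r)                                          ≡⟨ +-suc (size l) (size r) ⟩
  suc (size l + size r)                                          ∎

γ-positive : ∀ t → All (0 <_) (γ t)
γ-positive leaf = []
γ-positive (node l r) = ++⁺ (map⁺ (All.map (λ {x} x>0 → ≤-trans x>0 (m≤m+n x _)) (γ-positive l)))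
                            (m≤n+m 1 _ ∷ γ-positive r)

γ-≤size : ∀ t → All (_≤ size t) (γ t)
γ-≤size leaf = []
γ-≤size (node l r) = ++⁺ (map⁺ (All.map (λ x≤l → ≤-trans (+-monoˡ-≤ (size r) x≤l) (m≤n+m _ 1)) (γ-≤size l)))
  (≤-reflexive (+-comm _ 1) ∷ All.map (λ y≤r → ≤-trans y≤r (≤-trans (m≤n+m (size r) (size l)) (n≤1+n _))) (γ-≤size r))

γ-node : ∀ l r → γ (node l r) ≡ γ l ∨ₚ γ r
γ-node l r = cong₂ (λ a b → map (_+ b) (γ l) ++ (a + b + 1) ∷ γ r) (sym (length-γ l)) (sym (length-γ r))

st-γ : ∀ t → st (γ t) ≡ γ t
st-γ leaf = refl
st-γ (node l r) = begin
  st (γ (node l r))       ≡⟨ st-shifted-∨ (γ-positive l) (γ-≤size l) (γ-≤size r) ⟩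
  st (γ l) ∨ₚ st (γ r)    ≡⟨ cong₂ _∨ₚ_ (st-γ l) (st-γ r) ⟩
  γ l ∨ₚ γ r              ≡⟨ sym (γ-node l r) ⟩
  γ (node l r)            ∎

module _ (l r : Tree) where

  private
    α : List ℕ
    α = map (_+ size r) (γ l)

    length-α : length α ≡ size l
    length-α = trans (length-map _ (γ l)) (length-γ l)

  γ-node-split : ∀ {i} → ¬ i ≤ size l → i ≡ length α + suc (i ∸ suc (size l))
  γ-node-split i≰l = trans (m≰n⇒m≡n+[1+m∸1+n] i≰l) (cong (_+ _) (sym length-α))

  take-γ-node-≤ : ∀ {i} → i ≤ size l → take i (γ (node l r)) ≡ map (_+ size r) (take i (γ l))
  take-γ-node-≤ {i} i≤l = trans (take-++ˡ α _ (subst (i ≤_) (sym length-α) i≤l)) (take-map i (γ l))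

  drop-γ-node-≤ : ∀ {i} → i ≤ size l → drop i (γ (node l r)) ≡ map (_+ size r) (drop i (γ l)) ++ (size l + size r + 1) ∷ γ r
  drop-γ-node-≤ {i} i≤l = trans (drop-++ˡ α _ (subst (i ≤_) (sym length-α) i≤l)) (cong (_++ _) (drop-map i (γ l)))

st-take-γ : ∀ u i → st (take i (γ u)) ≡ γ (prefix u i)
st-take-γ leaf i = cong st (take-[] i)
st-take-γ (node l r) i with i ≤? size l
... | yes i≤l = begin
  st (take i (γ (node l r)))             ≡⟨ cong st (take-γ-node-≤ l r i≤l) ⟩
  st (map (_+ size r) (take i (γ l)))    ≡⟨ st-map-+ (size r) (take i (γ l)) ⟩
  st (take i (γ l))                      ≡⟨ st-take-γ l i ⟩
  γ (prefix l i)                         ∎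
... | no i≰l = begin
  st (take i (γ (node l r)))                                         ≡⟨ cong (λ n → st (take n (γ (node l r)))) (γ-node-split l r i≰l) ⟩
  st (take (length α + suc j) (α ++ m ∷ γ r))                        ≡⟨ cong st (take-++ʳ α (suc j) (m ∷ γ r)) ⟩
  st (α ++ m ∷ take j (γ r))                                         ≡⟨ st-shifted-∨ (γ-positive l) (γ-≤size l) (take⁺ j (γ-≤size r)) ⟩
  st (γ l) ∨ₚ st (take j (γ r))                                      ≡⟨ cong₂ _∨ₚ_ (st-γ l) (st-take-γ r j) ⟩
  γ l ∨ₚ γ (prefix r j)                                              ≡⟨ γ-node l (prefix r j) ⟨
  γ (node l (prefix r j))                                            ∎
  where
  j : ℕ
  j = i ∸ suc (size l)
  α : List ℕ
  α = map (_+ size r) (γ l)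
  m : ℕ
  m = size l + size r + 1

st-drop-γ : ∀ u i → st (drop i (γ u)) ≡ γ (suffix u i)
st-drop-γ leaf i = cong st (drop-[] i)
st-drop-γ (node l r) i with i ≤? size l
... | yes i≤l = begin
  st (drop i (γ (node l r)))                                         ≡⟨ cong st (drop-γ-node-≤ l r i≤l) ⟩
  st (map (_+ size r) (drop i (γ l)) ++ (size l + size r + 1) ∷ γ r) ≡⟨ st-shifted-∨ (drop⁺ i (γ-positive l)) (drop⁺ i (γ-≤size l)) (γ-≤size r) ⟩
  st (drop i (γ l)) ∨ₚ st (γ r)                                      ≡⟨ cong₂ _∨ₚ_ (st-drop-γ l i) (st-γ r) ⟩
  γ (suffix l i) ∨ₚ γ r                                              ≡⟨ γ-node (suffix l i) r ⟨
  γ (node (suffix l i) r)                                            ∎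
... | no i≰l = begin
  st (drop i (γ (node l r)))                                         ≡⟨ cong (λ n → st (drop n (γ (node l r)))) (γ-node-split l r i≰l) ⟩
  st (drop (length α + suc j) (α ++ (size l + size r + 1) ∷ γ r))    ≡⟨ cong st (drop-++ʳ α (suc j) _) ⟩
  st (drop j (γ r))                                                  ≡⟨ st-drop-γ r j ⟩
  γ (suffix r j)                                                     ∎
  where
  j : ℕ
  j = i ∸ suc (size l)
  α : List ℕ
  α = map (_+ size r) (γ l)

indexOf-++-∷ : ∀ {v} α β → All (_< v) α → indexOf v (α ++ v ∷ β) ≡ length α
indexOf-++-∷ {v} [] β [] with v ≡ᵇ v | ≡⇒≡ᵇ v v refl
... | true | _ = refl
indexOf-++-∷ {v} (x ∷ α) β (x<v ∷ α<v) with x ≡ᵇ v in x≡ᵇv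
... | true = ⊥-elim (<-irrefl (≡ᵇ⇒≡ x v (subst T (sym x≡ᵇv) _)) x<v)
... | false = cong suc (indexOf-++-∷ α β α<v)

lam-suc-++-∷ : ∀ k α m β → let σ = α ++ m ∷ β; j = indexOf (length σ) σ in
  lam (suc k) σ ≡ node (lam k (st (take j σ))) (lam k (st (drop (suc j) σ)))
lam-suc-++-∷ k [] m β = refl
lam-suc-++-∷ k (x ∷ α) m β = refl

lam-γ : ∀ {k} t → size t ≤ k → lam k (γ t) ≡ t
lam-γ {zero} leaf _ = refl
lam-γ {suc k} leaf _ = refl
lam-γ {suc k} (node l r) (s≤s l+r≤k) = begin
  lam (suc k) σ                                                ≡⟨ lam-suc-++-∷ k α m (γ r) ⟩
  node (lam k (st (take j σ))) (lam k (st (drop (suc j) σ)))   ≡⟨ cong₂ (λ x y → node (lam k (st x)) (lam k (st y))) take-j drop-1+j ⟩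
  node (lam k (st α)) (lam k (st (γ r)))                       ≡⟨ cong₂ (λ x y → node (lam k x) (lam k y)) (trans (st-map-+ (size r) (γ l)) (st-γ l)) (st-γ r) ⟩
  node (lam k (γ l)) (lam k (γ r))                             ≡⟨ cong₂ node (lam-γ l (≤-trans (m≤m+n (size l) (size r)) l+r≤k))
                                                                             (lam-γ r (≤-trans (m≤n+m (size r) (size l)) l+r≤k)) ⟩
  node l r                                                     ∎
  where
  α : List ℕ
  α = map (_+ size r) (γ l)
  m : ℕ
  m = size l + size r + 1
  σ : List ℕ
  σ = α ++ m ∷ γ r
  j : ℕ
  j = indexOf (length σ) σ
  j≡|α| : j ≡ length α
  j≡|α| = trans (cong (λ v → indexOf v σ) (trans (length-γ (node l r)) (+-comm 1 (size l + size r))))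
                (indexOf-++-∷ α (γ r) (map-+-bounded (size r) (γ-≤size l)))
  take-j : take j σ ≡ α
  take-j = trans (cong (λ n → take n σ) j≡|α|) (trans (take-++ˡ α _ ≤-refl) (take-all _ α ≤-refl))
  drop-1+j : drop (suc j) σ ≡ γ r
  drop-1+j = trans (cong (λ n → drop n σ) (trans (cong suc j≡|α|) (+-comm 1 (length α)))) (drop-++ʳ α 1 (m ∷ γ r))

Λ-γ : ∀ t → Λ (γ t) ≡ t
Λ-γ t = lam-γ t (≤-reflexive (sym (length-γ t)))

Λ-st-take-γ : ∀ u i → Λ (st (take i (γ u))) ≡ prefix u i
Λ-st-take-γ u i = trans (cong Λ (st-take-γ u i)) (Λ-γ (prefix u i))

Λ-st-drop-γ : ∀ u i → Λ (st (drop i (γ u))) ≡ suffix u i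
Λ-st-drop-γ u i = trans (cong Λ (st-drop-γ u i)) (Λ-γ (suffix u i))

module _ {A : Set} where

  sumℚ-cong : ∀ {F G : A → ℚ} L → (∀ x → F x ≡ G x) → sumℚ (map F L) ≡ sumℚ (map G L)
  sumℚ-cong L F≗G = cong sumℚ (map-cong F≗G L)

  sumℚ-zero : ∀ {F : A → ℚ} L → (∀ {x} → x ∈ L → F x ≡ 0ℚ) → sumℚ (map F L) ≡ 0ℚ
  sumℚ-zero [] _ = refl
  sumℚ-zero (x ∷ L) F≡0 = trans (cong₂ _+ℚ_ (F≡0 (here refl)) (sumℚ-zero L (F≡0 ∘ there))) (ℚ.+-identityˡ 0ℚ)

  sumℚ-single : ∀ {B : Set} (key : A → B) {F : A → ℚ} {L a} → Unique (map key L) → a ∈ L →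
    (∀ {y} → y ∈ L → ¬ key y ≡ key a → F y ≡ 0ℚ) → sumℚ (map F L) ≡ F a
  sumℚ-single key {F} {b ∷ L} (b∉L ∷ _) (here refl) F≡0 =
    trans (cong (F b +ℚ_) (sumℚ-zero L (λ y∈L → F≡0 (there y∈L) (λ e → All.lookup (map⁻ b∉L) y∈L (sym e))))) (ℚ.+-identityʳ (F b))
  sumℚ-single key {F} {b ∷ L} {a} (b∉L ∷ uL) (there a∈L) F≡0 =
    trans (cong₂ _+ℚ_ (F≡0 (here refl) (All.lookup (map⁻ b∉L) a∈L)) (sumℚ-single key uL a∈L (F≡0 ∘ there))) (ℚ.+-identityˡ (F a))

  sumℚ-*ʳ : ∀ (F : A → ℚ) c L → sumℚ (map (λ x → F x * c) L) ≡ sumℚ (map F L) * c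
  sumℚ-*ʳ F c [] = sym (ℚ.*-zeroˡ c)
  sumℚ-*ʳ F c (x ∷ L) = trans (cong (F x * c +ℚ_) (sumℚ-*ʳ F c L)) (sym (ℚ.*-distribʳ-+ c (F x) _))

  sumℚ-++ : ∀ (F : A → ℚ) L M → sumℚ (map F (L ++ M)) ≡ sumℚ (map F L) +ℚ sumℚ (map F M)
  sumℚ-++ F [] M = sym (ℚ.+-identityˡ _)
  sumℚ-++ F (x ∷ L) M = trans (cong (F x +ℚ_) (sumℚ-++ F L M)) (sym (ℚ.+-assoc (F x) _ _))

  sumℚ-difference : ∀ (F G : A → ℚ) L → sumℚ (map (λ x → F x - G x) L) ≡ sumℚ (map F L) - sumℚ (map G L)
  sumℚ-difference F G [] = refl
  sumℚ-difference F G (x ∷ L) = trans (cong ((F x - G x) +ℚ_) (sumℚ-difference F G L)) (interchange (F x) (G x) _ _)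
    where
    open +-*-Solverℚ
    interchange : ∀ a b c d → (a - b) +ℚ (c - d) ≡ (a +ℚ c) - (b +ℚ d)
    interchange = solve 4 (λ a b c d → (a :- b) :+ (c :- d) := (a :+ c) :- (b :+ d)) refl

  ∈⇒≤sum : ∀ (f : A → ℕ) {x L} → x ∈ L → f x ≤ sum (map f L)
  ∈⇒≤sum f {L = y ∷ L} (here refl) = m≤m+n (f y) _
  ∈⇒≤sum f {L = y ∷ L} (there x∈L) = ≤-trans (∈⇒≤sum f x∈L) (m≤n+m _ (f y))

-- Indicators of lower Tamari intervals

⊙-cong : ∀ {f f' g g' : Fun} → f ≗ f' → g ≗ g' → (f ⊙ g) ≗ (f' ⊙ g')
⊙-cong f≗f' g≗g' u = sumℚ-cong (upTo (suc (size u))) (λ i → cong₂ _*_ (f≗f' _) (g≗g' _))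

module _ (dec : ∀ s t → Dec (s ≤T t)) where

  χ : Tree → Fun
  χ t v = if ⌊ dec v t ⌋ then 1ℚ else 0ℚ

  χ-size : ∀ t v → ¬ size v ≡ size t → χ t v ≡ 0ℚ
  χ-size t v ≢size with dec v t
  ... | yes v≤t = ⊥-elim (≢size (≤T-size v≤t))
  ... | no _ = refl

  χ-refl : ∀ t → χ t t ≡ 1ℚ
  χ-refl t with dec t t
  ... | yes _ = refl
  ... | no t≰t = ⊥-elim (t≰t ε)

  unitLR≗χ-leaf : unitLR ≗ χ leaf
  unitLR≗χ-leaf u with leaf ≟T u | dec u leaf
  ... | yes refl | yes _ = refl
  ... | yes refl | no u≰u = ⊥-elim (u≰u ε)
  ... | no _ | no _ = refl
  ... | no leaf≢u | yes u≤leaf = ⊥-elim (leaf≢u (sym (size≡0 u (≤T-size u≤leaf))))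
    where
    size≡0 : ∀ t → size t ≡ 0 → t ≡ leaf
    size≡0 leaf _ = refl

  χ-prefix*suffix : ∀ s t u → χ s (prefix u (size s)) * χ t (suffix u (size s)) ≡ χ (s ⧵ t) u
  χ-prefix*suffix s t u with dec (prefix u (size s)) s | dec (suffix u (size s)) t | dec u (s ⧵ t)
  ... | yes p | yes q | yes _ = ℚ.*-identityˡ 1ℚ
  ... | yes p | yes q | no u≰s⧵t = ⊥-elim (u≰s⧵t (≤T-⧵⁺ p q))
  ... | _ | no q | yes u≤s⧵t = ⊥-elim (q (proj₂ (≤T-⧵⁻ u≤s⧵t)))
  ... | no p | _ | yes u≤s⧵t = ⊥-elim (p (proj₁ (≤T-⧵⁻ u≤s⧵t)))
  ... | yes p | no q | no _ = ℚ.*-zeroʳ 1ℚ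
  ... | no p | q | no _ = ℚ.*-zeroˡ (if ⌊ q ⌋ then 1ℚ else 0ℚ)

  χ-⊙ : ∀ s t u → (χ s ⊙ χ t) u ≡ χ (s ⧵ t) u
  χ-⊙ s t u = trans (sumℚ-cong (upTo (suc (size u))) split) (sum-terms (size s ≤? size u))
    where
    term : ℕ → ℚ
    term i = χ s (prefix u i) * χ t (suffix u i)
    split : ∀ i → χ s (Λ (st (take i (γ u)))) * χ t (Λ (st (drop i (γ u)))) ≡ term i
    split i = cong₂ (λ x y → χ s x * χ t y) (Λ-st-take-γ u i) (Λ-st-drop-γ u i)
    term-vanishes : ∀ {i} → i ∈ upTo (suc (size u)) → ¬ i ≡ size s → term i ≡ 0ℚ
    term-vanishes {i} i∈ i≢s = trans (cong (_* _) (χ-size s _ (i≢s ∘ trans (sym (size-prefix u (s≤s⁻¹ (∈-upTo⁻ i∈)))))))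
                                 (ℚ.*-zeroˡ (χ t (suffix u i)))
    sum-terms : Dec (size s ≤ size u) → sumℚ (map term (upTo (suc (size u)))) ≡ χ (s ⧵ t) u
    sum-terms (yes s≤u) = trans (sumℚ-single id (Unique.map⁺ id (upTo⁺ _)) (∈-upTo⁺ (s≤s s≤u)) term-vanishes)
                                (χ-prefix*suffix s t u)
    sum-terms (no s≰u) = trans (sumℚ-zero _ (λ i∈ → term-vanishes i∈ (λ { refl → s≰u (s≤s⁻¹ (∈-upTo⁻ i∈)) })))
                               (sym (χ-size (s ⧵ t) u (λ u≡s⧵t → s≰u (subst (size s ≤_) (sym u≡s⧵t) s≤s⧵t))))
      where
      s≤s⧵t : size s ≤ size (s ⧵ t)
      s≤s⧵t = subst (size s ≤_) (sym (size-⧵ s t)) (m≤m+n (size s) (size t))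

-- The dual basis {M*_t}

δ-refl : ∀ s → δ s s ≡ 1ℚ
δ-refl s with s ≟T s
... | yes _ = refl
... | no s≢s = ⊥-elim (s≢s refl)

δ-sym : ∀ s t → δ s t ≡ δ t s
δ-sym s t with s ≟T t | t ≟T s
... | yes refl | yes _ = refl
... | yes refl | no s≢s = ⊥-elim (s≢s refl)
... | no s≢t | yes refl = ⊥-elim (s≢t refl)
... | no _ | no _ = refl

module _ (dec : ∀ s t → Dec (s ≤T t)) {μ : Tree → Tree → ℚ} where

  intervalTerm : Tree → Tree → Tree → ℚ
  intervalTerm s t v = if ⌊ dec s v ⌋ ∧ ⌊ dec v t ⌋ then μ s v else 0ℚ

  pairM-difference : ∀ φ ψ s → pairM dec μ (λ v → φ v - ψ v) s ≡ pairM dec μ φ s - pairM dec μ ψ s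
  pairM-difference φ ψ s = trans (sumℚ-cong (trees (size s)) term) (sumℚ-difference _ _ (trees (size s)))
    where
    open +-*-Solverℚ
    term : ∀ v → (if ⌊ dec s v ⌋ then μ s v * (φ v - ψ v) else 0ℚ)
               ≡ (if ⌊ dec s v ⌋ then μ s v * φ v else 0ℚ) - (if ⌊ dec s v ⌋ then μ s v * ψ v else 0ℚ)
    term v with ⌊ dec s v ⌋
    ... | true = solve 3 (λ a x y → a :* (x :- y) := a :* x :- a :* y) refl (μ s v) (φ v) (ψ v)
    ... | false = sym (ℚ.+-inverseʳ 0ℚ)

  module _ (mobius : IsMobius dec μ) where

    pairM-χ : ∀ t s → pairM dec μ (χ dec t) s ≡ δ t s
    pairM-χ t s = trans (sumℚ-cong (trees (size s)) term) (sum-interval (dec s t))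
      where
      term : ∀ v → (if ⌊ dec s v ⌋ then μ s v * χ dec t v else 0ℚ) ≡ intervalTerm s t v
      term v with dec s v | dec v t
      ... | yes _ | yes _ = ℚ.*-identityʳ (μ s v)
      ... | yes _ | no _ = ℚ.*-zeroʳ (μ s v)
      ... | no _ | _ = refl
      sum-interval : Dec (s ≤T t) → sumℚ (map (intervalTerm s t) (trees (size s))) ≡ δ t s
      sum-interval (yes s≤t) = trans (mobius s t s≤t) (δ-sym s t)
      sum-interval (no s≰t) = trans (sumℚ-zero (trees (size s)) (λ {v} _ → empty v)) (sym δ≡0)
        where
        empty : ∀ v → intervalTerm s t v ≡ 0ℚ
        empty v with dec s v | dec v t
        ... | yes s≤v | yes v≤t = ⊥-elim (s≰t (s≤v ◅◅ v≤t))
        ... | yes _ | no _ = refl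
        ... | no _ | _ = refl
        δ≡0 : δ t s ≡ 0ℚ
        δ≡0 with t ≟T s
        ... | yes refl = ⊥-elim (s≰t ε)
        ... | no _ = refl

    pairM-triangular : ∀ {φ} s → (∀ {t} → s <T t → φ t ≡ 0ℚ) → pairM dec μ φ s ≡ φ s
    pairM-triangular {φ} s φ≡0-above = begin
      pairM dec μ φ s                                                ≡⟨ sumℚ-cong (trees (size s)) term ⟩
      sumℚ (map (λ v → intervalTerm s s v * φ s) (trees (size s)))   ≡⟨ sumℚ-*ʳ (intervalTerm s s) (φ s) (trees (size s)) ⟩
      sumℚ (map (intervalTerm s s) (trees (size s))) * φ s           ≡⟨ cong (_* φ s) (trans (mobius s s ε) (δ-refl s)) ⟩
      1ℚ * φ s                                                       ≡⟨ ℚ.*-identityˡ (φ s) ⟩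
      φ s                                                            ∎
      where
      term : ∀ v → (if ⌊ dec s v ⌋ then μ s v * φ v else 0ℚ) ≡ intervalTerm s s v * φ s
      term v with dec s v | dec v s
      ... | no _ | _ = sym (ℚ.*-zeroˡ (φ s))
      ... | yes s≤v | yes v≤s = cong (λ x → μ s v * φ x) (sym (≤T-antisym s≤v v≤s))
      ... | yes s≤v | no v≰s = begin
        μ s v * φ v   ≡⟨ cong (μ s v *_) (φ≡0-above (s≤v , λ { refl → v≰s ε })) ⟩
        μ s v * 0ℚ    ≡⟨ ℚ.*-zeroʳ (μ s v) ⟩
        0ℚ            ≡⟨ ℚ.*-zeroˡ (φ s) ⟨
        0ℚ * φ s      ∎

    pairM≡0⇒≡0 : ∀ n {φ} → (∀ s → size s ≡ n → pairM dec μ φ s ≡ 0ℚ) → ∀ s → size s ≡ n → φ s ≡ 0ℚ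
    pairM≡0⇒≡0 n {φ} pair≡0 = >T-rec (λ s → size s ≡ n → φ s ≡ 0ℚ) λ s φ≡0-above size≡n →
      trans (sym (pairM-triangular s (λ s<t → φ≡0-above s<t (trans (sym (≤T-size (proj₁ s<t))) size≡n)))) (pair≡0 s size≡n)

    dualBasis≡χ : ∀ {Mst} → IsDualBasis dec μ Mst → ∀ t v → Mst t v ≡ χ dec t v
    dualBasis≡χ {Mst} (off-degree , dual) t v with size v ≟ size t
    ... | no ≢size = trans (off-degree t v ≢size) (sym (χ-size dec t v ≢size))
    ... | yes ≡size = x∙y⁻¹≈ε⇒x≈y _ _ (pairM≡0⇒≡0 (size t) difference≡0 v ≡size)
      where
      difference≡0 : ∀ s → size s ≡ size t → pairM dec μ (λ v → Mst t v - χ dec t v) s ≡ 0ℚ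
      difference≡0 s size≡ = begin
        pairM dec μ (λ v → Mst t v - χ dec t v) s           ≡⟨ pairM-difference (Mst t) (χ dec t) s ⟩
        pairM dec μ (Mst t) s - pairM dec μ (χ dec t) s     ≡⟨ cong₂ _-_ (dual t s size≡) (pairM-χ t s) ⟩
        δ t s - δ t s                                       ≡⟨ ℚ.+-inverseʳ (δ t s) ⟩
        0ℚ                                                  ∎

-- The indicators form a basis

private
  treesOfHeight≤ : ℕ → List Tree
  treesOfHeight≤ zero = leaf ∷ []
  treesOfHeight≤ (suc n) = leaf ∷ concatMap (λ l → map (node l) (treesOfHeight≤ n)) (treesOfHeight≤ n)

  ∈-treesOfHeight≤ : ∀ {n} t → size t ≤ n → t ∈ treesOfHeight≤ n
  ∈-treesOfHeight≤ {zero} leaf _ = here refl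
  ∈-treesOfHeight≤ {suc n} leaf _ = here refl
  ∈-treesOfHeight≤ {suc n} (node l r) (s≤s l+r≤n) =
    there (∈-concatMap⁺ (λ l → map (node l) (treesOfHeight≤ n))
      (Any.map (λ { refl → ∈-map⁺ (node l) (∈-treesOfHeight≤ r (≤-trans (m≤n+m (size r) (size l)) l+r≤n)) })
               (∈-treesOfHeight≤ l (≤-trans (m≤m+n (size l) (size r)) l+r≤n))))

treesUpTo : ℕ → List Tree
treesUpTo N = filter (λ t → size t ≤? N) (deduplicate _≟T_ (treesOfHeight≤ N))

treesUpTo-unique : ∀ N → Unique (treesUpTo N)
treesUpTo-unique N = Unique.filter⁺ (λ t → size t ≤? N) (DecUnique.deduplicate-! _≟T_ (treesOfHeight≤ N))

∈-treesUpTo⁺ : ∀ {N t} → size t ≤ N → t ∈ treesUpTo N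
∈-treesUpTo⁺ {N} {t} t≤N = ∈-filter⁺ (λ t → size t ≤? N) (∈-deduplicate⁺ _≟T_ (∈-treesOfHeight≤ t t≤N)) t≤N

∈-treesUpTo⁻ : ∀ {N t} → t ∈ treesUpTo N → size t ≤ N
∈-treesUpTo⁻ {N} t∈ = proj₂ (∈-filter⁻ (λ t → size t ≤? N) {xs = deduplicate _≟T_ (treesOfHeight≤ N)} t∈)

weightBound : ℕ → ℕ
weightBound N = sum (map (suc ∘ leftWeight) (treesUpTo N))

leftWeight<weightBound : ∀ {N t} → size t ≤ N → leftWeight t < weightBound N
leftWeight<weightBound t≤N = ∈⇒≤sum (suc ∘ leftWeight) (∈-treesUpTo⁺ t≤N)

level : ℕ → ℕ → List Tree
level N k = filter (λ t → leftWeight t ≟ k) (treesUpTo N)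

level-unique : ∀ N k → Unique (level N k)
level-unique N k = Unique.filter⁺ (λ t → leftWeight t ≟ k) (treesUpTo-unique N)

∈-level⁺ : ∀ {N k t} → size t ≤ N → leftWeight t ≡ k → t ∈ level N k
∈-level⁺ {N} {k} t≤N lw≡k = ∈-filter⁺ (λ t → leftWeight t ≟ k) (∈-treesUpTo⁺ t≤N) lw≡k

∈-level⁻ : ∀ {N k t} → t ∈ level N k → size t ≤ N × leftWeight t ≡ k
∈-level⁻ {N} {k} t∈ with t∈treesUpTo , lw≡k ← ∈-filter⁻ (λ t → leftWeight t ≟ k) {xs = treesUpTo N} t∈ =
  ∈-treesUpTo⁻ t∈treesUpTo , lw≡k

module _ (dec : ∀ s t → Dec (s ≤T t)) where

  combχ : List (ℚ × Tree) → Fun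
  combχ ct u = sumℚ (map (λ x → proj₁ x * χ dec (proj₂ x) u) ct)

  χ-independent : ∀ ct → Unique (map proj₂ ct) → (∀ u → combχ ct u ≡ 0ℚ) → All (λ x → proj₁ x ≡ 0ℚ) ct
  χ-independent ct unique comb≡0 = All.tabulate (λ {x} x∈ct → >T-rec CoefficientsVanishAt step (proj₂ x) x∈ct refl)
    where
    CoefficientsVanishAt : Tree → Set
    CoefficientsVanishAt T = ∀ {x} → x ∈ ct → proj₂ x ≡ T → proj₁ x ≡ 0ℚ
    step : ∀ T → (∀ {T'} → T <T T' → CoefficientsVanishAt T') → CoefficientsVanishAt T
    step T ih {x} x∈ct refl = begin
      proj₁ x                ≡⟨ ℚ.*-identityʳ (proj₁ x) ⟨
      proj₁ x * 1ℚ           ≡⟨ cong (proj₁ x *_) (χ-refl dec T) ⟨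
      proj₁ x * χ dec T T    ≡⟨ sumℚ-single proj₂ unique x∈ct others-vanish ⟨
      combχ ct T             ≡⟨ comb≡0 T ⟩
      0ℚ                     ∎
      where
      others-vanish : ∀ {y} → y ∈ ct → ¬ proj₂ y ≡ T → proj₁ y * χ dec (proj₂ y) T ≡ 0ℚ
      others-vanish {y} y∈ct y≢T with dec T (proj₂ y)
      ... | no _ = ℚ.*-zeroʳ (proj₁ y)
      ... | yes T≤y = trans (cong (_* 1ℚ) (ih (T≤y , y≢T ∘ sym) y∈ct refl)) (ℚ.*-zeroˡ 1ℚ)

  module _ (N : ℕ) (g : Fun) (k : ℕ) where

    levelPart : List (ℚ × Tree)
    levelPart = map (λ T → g T , T) (level N k)

    combχ-levelPart : ∀ u → combχ levelPart u ≡ sumℚ (map (λ T → g T * χ dec T u) (level N k))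
    combχ-levelPart u = cong sumℚ (sym (map-∘ (level N k)))

    levelPart-vanishes-above : ∀ u → N < size u → combχ levelPart u ≡ 0ℚ
    levelPart-vanishes-above u N<u = trans (combχ-levelPart u) (sumℚ-zero (level N k) λ {T} T∈ →
      trans (cong (g T *_) (χ-size dec T u (λ e → <⇒≱ N<u (≤-trans (≤-reflexive e) (proj₁ (∈-level⁻ {N} {k} T∈)))))) (ℚ.*-zeroʳ (g T)))

    levelPart-vanishes-below : ∀ u → leftWeight u < k → combχ levelPart u ≡ 0ℚ
    levelPart-vanishes-below u u<k = trans (combχ-levelPart u) (sumℚ-zero (level N k) vanish)
      where
      vanish : ∀ {T} → T ∈ level N k → g T * χ dec T u ≡ 0ℚ
      vanish {T} T∈ with dec u T
      ... | no _ = ℚ.*-zeroʳ (g T)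
      ... | yes u≤T = ⊥-elim (<⇒≱ u<k (≤-trans (≤-reflexive (sym (proj₂ (∈-level⁻ {N} {k} T∈)))) (≤T-leftWeight u≤T)))

    levelPart-on-level : ∀ u → size u ≤ N → leftWeight u ≡ k → combχ levelPart u ≡ g u
    levelPart-on-level u u≤N u≡k = begin
      combχ levelPart u                                  ≡⟨ combχ-levelPart u ⟩
      sumℚ (map (λ T → g T * χ dec T u) (level N k))     ≡⟨ sumℚ-single id (Unique.map⁺ id (level-unique N k)) (∈-level⁺ u≤N u≡k) vanish ⟩
      g u * χ dec u u                                    ≡⟨ cong (g u *_) (χ-refl dec u) ⟩
      g u * 1ℚ                                           ≡⟨ ℚ.*-identityʳ (g u) ⟩
      g u                                                ∎
      where
      vanish : ∀ {T} → T ∈ level N k → ¬ T ≡ u → g T * χ dec T u ≡ 0ℚ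
      vanish {T} T∈ T≢u with dec u T
      ... | no _ = ℚ.*-zeroʳ (g T)
      ... | yes u≤T = ⊥-elim (<-irrefl (trans (proj₂ (∈-level⁻ {N} {k} T∈)) (sym u≡k)) (<T-leftWeight (u≤T , T≢u ∘ sym)))

  InSpanχ : Fun → Set
  InSpanχ g = ∃ λ ct → g ≗ combχ ct

  -- Subtracting Σ_{T at leftWeight k} g T · χ T kills g on leftWeight k without reviving it
  -- below: χ T vanishes at every u ≠ T with leftWeight u ≤ leftWeight T.
  span-from-level : ∀ N d k → d + k ≡ weightBound N → ∀ g →
    (∀ u → N < size u → g u ≡ 0ℚ) → (∀ u → leftWeight u < k → g u ≡ 0ℚ) → InSpanχ g
  span-from-level N zero k k≡bound g above below = [] , g≡0
    where
    g≡0 : ∀ u → g u ≡ 0ℚ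
    g≡0 u with size u ≤? N
    ... | yes u≤N = below u (<-≤-trans (leftWeight<weightBound u≤N) (≤-reflexive (sym k≡bound)))
    ... | no u≰N = above u (≰⇒> u≰N)
  span-from-level N (suc d) k 1+d+k≡bound g above below =
    add-level (span-from-level N d (suc k) (trans (+-suc d k) 1+d+k≡bound) rest rest-above rest-below)
    where
    part : List (ℚ × Tree)
    part = levelPart N g k
    rest : Fun
    rest u = g u - combχ part u
    rest-above : ∀ u → N < size u → rest u ≡ 0ℚ
    rest-above u N<u = trans (cong₂ _-_ (above u N<u) (levelPart-vanishes-above N g k u N<u)) (ℚ.+-inverseʳ 0ℚ)
    rest-below : ∀ u → leftWeight u < suc k → rest u ≡ 0ℚ
    rest-below u u<1+k with m<1+n⇒m<n∨m≡n u<1+k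
    ... | inj₁ u<k = trans (cong₂ _-_ (below u u<k) (levelPart-vanishes-below N g k u u<k)) (ℚ.+-inverseʳ 0ℚ)
    ... | inj₂ u≡k with size u ≤? N
    ...   | yes u≤N = trans (cong (g u -_) (levelPart-on-level N g k u u≤N u≡k)) (ℚ.+-inverseʳ (g u))
    ...   | no u≰N = rest-above u (≰⇒> u≰N)
    add-level : InSpanχ rest → InSpanχ g
    add-level (ct , rest≗ct) = ct ++ part , λ u → begin
      g u                               ≡⟨ //-rightDividesˡ (combχ part u) (g u) ⟨
      rest u +ℚ combχ part u            ≡⟨ cong (_+ℚ combχ part u) (rest≗ct u) ⟩
      combχ ct u +ℚ combχ part u        ≡⟨ sumℚ-++ _ ct part ⟨
      combχ (ct ++ part) u              ∎

  χ-span : ∀ g → FinDeg g → InSpanχ g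
  χ-span g (N , above) = span-from-level N (weightBound N) 0 (+-identityʳ _) g above (λ u ())

-- Monomials in progressive trees

node-injectiveˡ : ∀ {a b c d} → node a b ≡ node c d → a ≡ c
node-injectiveˡ refl = refl

node-injectiveʳ : ∀ {a b c d} → node a b ≡ node c d → b ≡ d
node-injectiveʳ refl = refl

progressiveWord : Tree → List Tree
progressiveWord leaf = []
progressiveWord (node l r) = node l leaf ∷ progressiveWord r

progressiveWord-progressive : ∀ t → All Progressive (progressiveWord t)
progressiveWord-progressive leaf = []
progressiveWord-progressive (node l r) = prog l ∷ progressiveWord-progressive r

foldr-⧵-progressiveWord : ∀ t → foldr _⧵_ leaf (progressiveWord t) ≡ t
foldr-⧵-progressiveWord leaf = refl
foldr-⧵-progressiveWord (node l r) = cong (node l) (foldr-⧵-progressiveWord r)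

foldr-⧵-injective : ∀ {w w'} → All Progressive w → All Progressive w' → foldr _⧵_ leaf w ≡ foldr _⧵_ leaf w' → w ≡ w'
foldr-⧵-injective [] [] _ = refl
foldr-⧵-injective [] (prog _ ∷ _) ()
foldr-⧵-injective (prog _ ∷ _) [] ()
foldr-⧵-injective (prog l ∷ pw) (prog l' ∷ pw') e =
  cong₂ _∷_ (cong (λ x → node x leaf) (node-injectiveˡ e)) (foldr-⧵-injective pw pw' (node-injectiveʳ e))

map-foldr-⧵-unique : ∀ {ws} → All (All Progressive) ws → Unique ws → Unique (map (foldr _⧵_ leaf) ws)
map-foldr-⧵-unique [] [] = []
map-foldr-⧵-unique (pw ∷ pws) (w∉ws ∷ uws) =
  map⁺ (All.zipWith (λ (w≢w' , pw') → w≢w' ∘ foldr-⧵-injective pw pw') (w∉ws , pws)) ∷ map-foldr-⧵-unique pws uws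

module _ (dec : ∀ s t → Dec (s ≤T t)) {μ : Tree → Tree → ℚ} (mobius : IsMobius dec μ)
         {Mst : Tree → Fun} (dual : IsDualBasis dec μ Mst) where

  private
    Mst≗χ : ∀ t → Mst t ≗ χ dec t
    Mst≗χ = dualBasis≡χ dec mobius dual

  Mst-⊙ : ∀ s t → (Mst s ⊙ Mst t) ≗ Mst (s ⧵ t)
  Mst-⊙ s t u = trans (⊙-cong (Mst≗χ s) (Mst≗χ t) u) (trans (χ-⊙ dec s t u) (sym (Mst≗χ (s ⧵ t) u)))

  wordProd≗χ : ∀ w → wordProd Mst w ≗ χ dec (foldr _⧵_ leaf w)
  wordProd≗χ [] = unitLR≗χ-leaf dec
  wordProd≗χ (p ∷ w) u = trans (⊙-cong (Mst≗χ p) (wordProd≗χ w) u) (χ-⊙ dec p (foldr _⧵_ leaf w) u)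

  lincomb≗combχ : ∀ cw → lincomb Mst cw ≗ combχ dec (map (map₂ (foldr _⧵_ leaf)) cw)
  lincomb≗combχ cw u = trans (sumℚ-cong cw (λ x → cong (proj₁ x *_) (wordProd≗χ (proj₂ x) u))) (cong sumℚ (map-∘ cw))

  monomials-independent : ∀ cw → All (λ x → All Progressive (proj₂ x)) cw → Unique (map proj₂ cw) →
    (∀ u → lincomb Mst cw u ≡ 0ℚ) → All (λ x → proj₁ x ≡ 0ℚ) cw
  monomials-independent cw progressive unique lincomb≡0 =
    map⁻ (χ-independent dec (map (map₂ (foldr _⧵_ leaf)) cw) trees-unique
                            (λ u → trans (sym (lincomb≗combχ cw u)) (lincomb≡0 u)))
    where
    trees-unique : Unique (map proj₂ (map (map₂ (foldr _⧵_ leaf)) cw))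
    trees-unique = subst Unique (trans (sym (map-∘ cw)) (map-∘ cw)) (map-foldr-⧵-unique (map⁺ progressive) unique)

  monomials-span : ∀ f → FinDeg f →
    ∃ λ cw → All (λ x → All Progressive (proj₂ x)) cw × (∀ u → f u ≡ lincomb Mst cw u)
  monomials-span f finite with ct , f≗ct ← χ-span dec f finite =
    cw , map⁺ (All.tabulate (λ {x} _ → progressiveWord-progressive (proj₂ x))) , λ u → begin
      f u                                          ≡⟨ f≗ct u ⟩
      combχ dec ct u                               ≡⟨ cong (λ ct' → combχ dec ct' u) words-fold ⟨
      combχ dec (map (map₂ (foldr _⧵_ leaf)) cw) u  ≡⟨ lincomb≗combχ cw u ⟨
      lincomb Mst cw u                             ∎
    where
    cw : List (ℚ × List Tree)
    cw = map (map₂ progressiveWord) ct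
    words-fold : map (map₂ (foldr _⧵_ leaf)) cw ≡ ct
    words-fold = trans (sym (map-∘ ct)) (map-id-local (All.tabulate (λ {x} _ → cong (proj₁ x ,_) (foldr-⧵-progressiveWord (proj₂ x)))))

theorem8p1 : (dec : ∀ s t → Dec (s ≤T t)) (μ : Tree → Tree → ℚ) → IsMobius dec μ →
    (Mst : Tree → Fun) → IsDualBasis dec μ Mst →
    IsFreeOnProgressive Mst × (∀ s t u → (Mst s ⊙ Mst t) u ≡ Mst (s ⧵ t) u)
theorem8p1 dec μ mobius Mst dual =
  (monomials-independent dec mobius dual , monomials-span dec mobius dual) , Mst-⊙ dec mobius dual
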